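{- For every finite connected graph $G$ on $n$ vertices, $c_H(G)\le \lceil n/2\rceil$. Moreover, $c_H(K_n)=\lceil n/2\rceil$ for the complete graph $K_n$, so the bound is tight.
   Context: Hyperopic Cops and Robbers on a finite connected simple graph $G$: one player controls $k$ cops, the other a single robber. The cops first choose starting vertices (several cops may share a vertex), then the robber chooses a starting vertex; afterwards, in each round, each cop moves to an adjacent vertex or stays put, and then the robber moves to an adjacent vertex or stays put. The robber always knows the cops' positions. The robber is invisible to the cops exactly when the robber's vertex is adjacent to the vertex of every cop (a robber on the same vertex as a cop is visible); otherwise the cops see the robber's position. The cops win if after finitely many rounds some cop occupies the robber's vertex, and the cops' strategy must guarantee this with certainty (no chance allowed). The hyperopic cop number $c_H(G)$ is the minimum $k$ for which $k$ cops have a winning strategy. -}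

module Defs where

open import Data.Nat using (ℕ; zero; suc; _≤_; _<_)
open import Data.Fin using (Fin; _≟_)
import Data.Fin
open import Data.Bool using (Bool; true; false; not; _∧_)
open import Data.Maybe using (Maybe; just; nothing)
open import Data.List using (List; []; _∷_)
open import Data.Product using (Σ; ∃; _×_; _,_)
open import Data.Sum using (_⊎_)
open import Relation.Nullary using (¬_; yes; no)
open import Relation.Nullary.Decidable using (⌊_⌋)
open import Relation.Binary.PropositionalEquality using (_≡_; refl; sym)

record Graph (n : ℕ) : Set where
  field
    adj    : Fin n → Fin n → Bool
    adj-sym : ∀ u v → adj u v ≡ adj v u
    adj-irrefl : ∀ v → adj v v ≡ false
open Graph public

Adj : ∀ {n} → Graph n → Fin n → Fin n → Set
Adj G u v = adj G u v ≡ true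

data Reachable {n} (G : Graph n) : Fin n → Fin n → Set where
  here : ∀ {u} → Reachable G u u
  step : ∀ {u v w} → Adj G u v → Reachable G v w → Reachable G u w

Connected : ∀ {n} → Graph n → Set
Connected G = ∀ u v → Reachable G u v

private
  ≟-sym : ∀ {n} (u v : Fin n) → not ⌊ u ≟ v ⌋ ≡ not ⌊ v ≟ u ⌋
  ≟-sym u v with u ≟ v | v ≟ u
  ... | yes _ | yes _ = refl
  ... | no _  | no _  = refl
  ... | yes p | no q  = Data.Empty.⊥-elim (q (sym p))
    where import Data.Empty
  ... | no p  | yes q = Data.Empty.⊥-elim (p (sym q))
    where import Data.Empty

  ≟-refl : ∀ {n} (v : Fin n) → not ⌊ v ≟ v ⌋ ≡ false
  ≟-refl v with v ≟ v
  ... | yes _ = refl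
  ... | no p  = Data.Empty.⊥-elim (p refl)
    where import Data.Empty

K : (n : ℕ) → Graph n
K n = record
  { adj = λ u v → not ⌊ u ≟ v ⌋
  ; adj-sym = ≟-sym
  ; adj-irrefl = ≟-refl
  }

Config : ℕ → ℕ → Set
Config n k = Fin k → Fin n

-- what the cops observe about the robber: nothing = invisible,
-- just v = robber seen at vertex v
Obs : ℕ → Set
Obs n = Maybe (Fin n)

allF : ∀ {k} → (Fin k → Bool) → Bool
allF {zero}  p = true
allF {suc k} p = p Data.Fin.zero ∧ allF (λ i → p (Data.Fin.suc i))

observe : ∀ {n k} → Graph n → Config n k → Fin n → Obs n
observe G c v with allF (λ i → adj G v (c i))
... | true  = nothing
... | false = just v

-- A (deterministic) cop strategy: starting positions, and the next
-- positions as a function of the whole history of observations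
-- (most recent observation first).  The cops' own positions are
-- determined by the history, so this is fully general.
record Strategy {n} (G : Graph n) (k : ℕ) : Set where
  field
    start : Config n k
    next  : List (Obs n) → Config n k
open Strategy public

Move : ∀ {n} → Graph n → Fin n → Fin n → Set
Move G u v = u ≡ v ⊎ Adj G u v

-- A robber walk: starting vertex r 0, and r (suc t) the robber's
-- position after its move in round t+1.
RobberWalk : ∀ {n} → Graph n → (ℕ → Fin n) → Set
RobberWalk G r = ∀ t → Move G (r t) (r (suc t))

-- The play of a strategy against a robber walk.
-- copsAt t   : cop positions after the cops' move in round t (t=0: start)
-- history t  : observations available when the cops choose round t+1;
--   it contains the observation at every position of the game so far
--   (after each cops' move and after each robber move).
module Play {n k} (G : Graph n) (σ : Strategy G k) (r : ℕ → Fin n) where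
  mutual
    copsAt : ℕ → Config n k
    copsAt zero    = start σ
    copsAt (suc t) = next σ (history t)

    history : ℕ → List (Obs n)
    history zero    = observe G (copsAt zero) (r zero) ∷ []
    history (suc t) =
      observe G (copsAt (suc t)) (r (suc t)) ∷
      observe G (copsAt (suc t)) (r t) ∷ history t

  -- capture in round t: a cop shares the robber's vertex at time t, or a
  -- cop moves onto the robber's vertex in round t+1
  CaughtAt : ℕ → Set
  CaughtAt t = ∃ λ (i : Fin k) → copsAt t i ≡ r t ⊎ copsAt (suc t) i ≡ r t

  LegalCops : Set
  LegalCops = ∀ t (i : Fin k) → Move G (copsAt t i) (copsAt (suc t) i)

-- σ is winning: against every robber walk (the robber chooses it knowing
-- the deterministic strategy, hence knowing all cop positions), the cops'
-- moves are legal and the robber is caught after finitely many rounds.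
Winning : ∀ {n k} (G : Graph n) → Strategy G k → Set
Winning G σ = ∀ r → RobberWalk G r →
  Play.LegalCops G σ r × ∃ λ t → Play.CaughtAt G σ r t

CopsWin : ∀ {n} → Graph n → ℕ → Set
CopsWin G k = ∃ λ (σ : Strategy G k) → Winning G σ

IsHyperopicCopNumber : ∀ {n} → Graph n → ℕ → Set
IsHyperopicCopNumber G m = CopsWin G m × (∀ k → k < m → ¬ CopsWin G k)

module Submission where

-- Colour the vertices of a connected graph (n ≥ 2) by the parity
-- of their distance from a root; every vertex then has a neighbour of the other
-- colour, so the smaller colour class A, of size ≤ ⌊n/2⌋, is dominating.  List
-- A first and the remaining vertices after it; cop i starts on the i-th vertex
-- of this list and is assigned the (⌈n/2⌉ + i)-th.  A visible robber is on or
-- next to a cop's vertex and is caught at once.  An invisible robber is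
-- adjacent to every cop, in particular to the cop assigned its vertex, who
-- steps onto it.
--
-- Against j cops on K n with 2j < n, the robber always stands on
-- a vertex free of cops both before and after their move.  In K n it is then
-- adjacent to every cop, so the cops never see it, their moves are fixed in
-- advance, and such a vertex exists in every round.

open import Defs
open import Data.Bool using (Bool; true; false; if_then_else_)
import Data.Bool.Properties as Boolₚ
open import Data.Fin as Fin using (Fin; _≟_; toℕ; fromℕ<; splitAt; _↑ˡ_; _↑ʳ_)
import Data.Fin.Properties as Finₚ
open import Data.List using (List; []; _∷_; _++_; length; filter; allFin)
open import Data.List.Properties using (length-++; length-tabulate)
open import Data.List.Membership.Propositional using (_∈_)
open import Data.List.Membership.Propositional.Properties using (∈-filter⁺; ∈-allFin; ∈-++⁺ˡ; ∈-++⁺ʳ)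
open import Data.List.Relation.Unary.Any using (here; there)
open import Data.Maybe using (just; nothing)
open import Data.Nat using (ℕ; zero; suc; _+_; _∸_; _≤_; _<_; z≤n; s≤s; s<s⁻¹; _<?_; parity; ⌊_/2⌋; ⌈_/2⌉)
open import Data.Nat.Properties
  using ( ≤-refl; ≤-trans; ≤-antisym; ≤-total; <-≤-trans; <⇒≱; ≰⇒>; ≮⇒≥
        ; +-identityʳ; +-suc; +-monoˡ-≤; +-monoʳ-≤; +-cancelˡ-<; m+[n∸m]≡n
        ; ⌊n/2⌋-mono; ⌈n/2⌉-mono; ⌊n/2⌋≤⌈n/2⌉; ⌊n/2⌋+⌈n/2⌉≡n; n≡⌊n+n/2⌋; n≡⌈n+n/2⌉ )
open import Data.Parity.Base using (Parity; 0ℙ; 1ℙ; _⁻¹)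
open import Data.Parity.Properties as Parityₚ using (suc-homo-⁻¹; ⁻¹-involutive; p≢p⁻¹)
open import Data.Product using (∃; _×_; _,_; proj₁; proj₂)
open import Data.Sum using (_⊎_; inj₁; inj₂; [_,_])
open import Function using (_∘_)
open import Relation.Nullary using (¬_; yes; no; contradiction)
open import Relation.Nullary.Decidable using (_×-dec_; _⊎-dec_)
open import Relation.Unary using (Pred; Decidable)
open import Relation.Binary.PropositionalEquality using (_≡_; _≢_; refl; sym; trans; cong; cong₂; cong-app; subst)

allF-true⁻ : ∀ {k} (p : Fin k → Bool) → allF p ≡ true → ∀ i → p i ≡ true
allF-true⁻ {suc k} p all-p i with p Fin.zero in p₀
allF-true⁻ {suc k} p all-p Fin.zero    | true = p₀
allF-true⁻ {suc k} p all-p (Fin.suc i) | true = allF-true⁻ (p ∘ Fin.suc) all-p i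

allF-true⁺ : ∀ {k} (p : Fin k → Bool) → (∀ i → p i ≡ true) → allF p ≡ true
allF-true⁺ {zero}  p all-p = refl
allF-true⁺ {suc k} p all-p rewrite all-p Fin.zero = allF-true⁺ (p ∘ Fin.suc) (all-p ∘ Fin.suc)

observe-cases : ∀ {n k} (G : Graph n) (c : Config n k) (v : Fin n) →
  (observe G c v ≡ nothing × (∀ i → Adj G v (c i))) ⊎ observe G c v ≡ just v
observe-cases G c v with allF (λ i → adj G v (c i)) in all-adj
... | true  = inj₁ (refl , allF-true⁻ _ all-adj)
... | false = inj₂ refl

observe-nothing : ∀ {n k} (G : Graph n) (c : Config n k) (v : Fin n) →
  (∀ i → Adj G v (c i)) → observe G c v ≡ nothing
observe-nothing G c v adjacent rewrite allF-true⁺ (λ i → adj G v (c i)) adjacent = refl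

-- Capture in the first round

module CoverStrategy {n k} (G : Graph n) (f g : Fin k → Fin n)
  (f-dominates : ∀ v → ∃ λ i → f i ≡ v ⊎ Adj G (f i) v)
  (f∪g-covers : ∀ v → (∃ λ i → f i ≡ v) ⊎ (∃ λ i → g i ≡ v)) where

  approach : Fin n → Fin n → Fin n
  approach a v = if adj G a v then v else a

  approach-move : ∀ a v → Move G a (approach a v)
  approach-move a v with adj G a v in a~v
  ... | true  = inj₂ a~v
  ... | false = inj₁ refl

  approach-reaches : ∀ a v → Adj G a v → approach a v ≡ v
  approach-reaches a v a~v rewrite a~v = refl

  respond : Obs n → Config n k
  respond (just v) i = approach (f i) v
  respond nothing  i = approach (f i) (g i)

  respond-move : ∀ o i → Move G (f i) (respond o i)
  respond-move (just v) i = approach-move (f i) v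
  respond-move nothing  i = approach-move (f i) (g i)

  respond-captures : ∀ v → ∃ λ i → f i ≡ v ⊎ respond (observe G f v) i ≡ v
  respond-captures v with observe-cases G f v
  ... | inj₂ visible rewrite visible with f-dominates v
  ...   | i , inj₁ fᵢ≡v = i , inj₁ fᵢ≡v
  ...   | i , inj₂ fᵢ~v = i , inj₂ (approach-reaches (f i) v fᵢ~v)
  respond-captures v | inj₁ (invisible , adjacent) rewrite invisible with f∪g-covers v
  ...   | inj₁ (i , fᵢ≡v) = i , inj₁ fᵢ≡v
  ...   | inj₂ (i , refl) = i , inj₂ (approach-reaches (f i) (g i) fᵢ~gᵢ)
    where
    fᵢ~gᵢ : Adj G (f i) (g i)
    fᵢ~gᵢ = trans (adj-sym G (f i) (g i)) (adjacent i)

  -- Histories grow by two observations per round, so this returns the response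
  -- to the initial observation: after round 1 the cops stay put.
  react : List (Obs n) → Config n k
  react []          = f
  react (o ∷ [])    = respond o
  react (_ ∷ _ ∷ h) = react h

  strategy : Strategy G k
  strategy = record { start = f ; next = react }

  wins : Winning G strategy
  wins r _ = legal , zero , respond-captures (r zero)
    where
    open Play G strategy r
    legal : LegalCops
    legal zero    i = respond-move (observe G f (r zero)) i
    legal (suc t) i = inj₁ refl

Dominates : ∀ {n} → Graph n → List (Fin n) → Set
Dominates G A = ∀ v → ∃ λ u → u ∈ A × (u ≡ v ⊎ Adj G u v)

-- The J-th element of a list, or the default d past its end.
entry : ∀ {a} {A : Set a} → A → List A → ℕ → A
entry d []       _       = d
entry d (x ∷ xs) zero    = x
entry d (x ∷ xs) (suc J) = entry d xs J

entry-∈ : ∀ {a} {A : Set a} (d : A) {x xs} → x ∈ xs → ∃ λ J → J < length xs × entry d xs J ≡ x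
entry-∈ d (here refl)  = zero , s≤s z≤n , refl
entry-∈ d (there x∈xs) with entry-∈ d x∈xs
... | J , J<len , xs[J]≡x = suc J , s≤s J<len , xs[J]≡x

entry-++ˡ : ∀ {a} {A : Set a} (d : A) xs {ys J} → J < length xs → entry d (xs ++ ys) J ≡ entry d xs J
entry-++ˡ d (x ∷ xs) {J = zero}  _            = refl
entry-++ˡ d (x ∷ xs) {J = suc J} (s≤s J<len) = entry-++ˡ d xs J<len

below-double : ∀ {k J} → J < k + k → (∃ λ (i : Fin k) → toℕ i ≡ J) ⊎ (∃ λ (i : Fin k) → k + toℕ i ≡ J)
below-double {k} {J} J<2k with J <? k
... | yes J<k = inj₁ (fromℕ< J<k , Finₚ.toℕ-fromℕ< J<k)
... | no  J≮k = inj₂ (fromℕ< J∸k<k , trans (cong (k +_) (Finₚ.toℕ-fromℕ< J∸k<k)) (m+[n∸m]≡n k≤J))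
  where
  k≤J : k ≤ J
  k≤J = ≮⇒≥ J≮k
  J∸k<k : J ∸ k < k
  J∸k<k = +-cancelˡ-< k (J ∸ k) k (subst (_< k + k) (sym (m+[n∸m]≡n k≤J)) J<2k)

dominatingList⇒copsWin : ∀ {m k} (G : Graph (suc m)) (A B : List (Fin (suc m))) →
  Dominates G A → (∀ v → v ∈ A ++ B) → length A ≤ k → length (A ++ B) ≤ k + k → CopsWin G k
dominatingList⇒copsWin {m} {k} G A B A-dominates A++B-covers |A|≤k |A++B|≤2k = strategy , wins
  where
  position : ℕ → Fin (suc m)
  position = entry Fin.zero (A ++ B)

  f g : Fin k → Fin (suc m)
  f i = position (toℕ i)
  g i = position (k + toℕ i)

  f-covers-A : ∀ {u} → u ∈ A → ∃ λ i → f i ≡ u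
  f-covers-A u∈A with entry-∈ Fin.zero u∈A
  ... | J , J<|A| , A[J]≡u =
    fromℕ< J<k , trans (cong position (Finₚ.toℕ-fromℕ< J<k)) (trans (entry-++ˡ Fin.zero A J<|A|) A[J]≡u)
    where
    J<k : J < k
    J<k = <-≤-trans J<|A| |A|≤k

  f-dominates : ∀ v → ∃ λ i → f i ≡ v ⊎ Adj G (f i) v
  f-dominates v with A-dominates v
  ... | u , u∈A , u≡v⊎u~v with f-covers-A u∈A
  ...   | i , refl = i , u≡v⊎u~v

  f∪g-covers : ∀ v → (∃ λ i → f i ≡ v) ⊎ (∃ λ i → g i ≡ v)
  f∪g-covers v with entry-∈ Fin.zero (A++B-covers v)
  ... | J , J<len , L[J]≡v with below-double (<-≤-trans J<len |A++B|≤2k)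
  ...   | inj₁ (i , i≡J)   = inj₁ (i , trans (cong position i≡J) L[J]≡v)
  ...   | inj₂ (i , k+i≡J) = inj₂ (i , trans (cong position k+i≡J) L[J]≡v)

  open CoverStrategy G f g f-dominates f∪g-covers

-- Distance layers and the parity colouring

least : ∀ {p} {P : Pred ℕ p} → Decidable P → ℕ → ℕ
least P? zero = zero
least P? (suc b) with P? zero
... | yes _ = zero
... | no  _ = suc (least (P? ∘ suc) b)

least-holds : ∀ {p} {P : Pred ℕ p} (P? : Decidable P) b → P b → P (least P? b)
least-holds P? zero    Pb = Pb
least-holds P? (suc b) Pb with P? zero
... | yes P0 = P0
... | no  _  = least-holds (P? ∘ suc) b Pb

least-minimal : ∀ {p} {P : Pred ℕ p} (P? : Decidable P) b {s} → s < least P? b → ¬ P s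
least-minimal P? (suc b) {s} s<least with P? zero
least-minimal P? (suc b) {zero}  s<least | no ¬P0 = ¬P0
least-minimal P? (suc b) {suc s} s<least | no _   = least-minimal (P? ∘ suc) b (s<s⁻¹ s<least)

least-≤ : ∀ {p} {P : Pred ℕ p} (P? : Decidable P) b {s} → P s → least P? b ≤ s
least-≤ P? b Ps = ≮⇒≥ (λ s<least → least-minimal P? b s<least Ps)

walkLength : ∀ {n} {G : Graph n} {u v} → Reachable G u v → ℕ
walkLength here       = zero
walkLength (step _ w) = suc (walkLength w)

firstNeighbour : ∀ {n} {G : Graph n} {u v} → Reachable G u v → u ≢ v → ∃ λ w → Adj G u w
firstNeighbour here           u≢u = contradiction refl u≢u
firstNeighbour (step u~w _) _   = _ , u~w

OppositeNeighbours : ∀ {n} → Graph n → (Fin n → Parity) → Set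
OppositeNeighbours G col = ∀ v → ∃ λ u → Adj G u v × col u ≡ col v ⁻¹

module Distance {n} (G : Graph n) (ρ : Fin n) (reach : ∀ v → Reachable G ρ v) where

  Within : ℕ → Fin n → Set
  Within zero    v = v ≡ ρ
  Within (suc t) v = Within t v ⊎ ∃ λ u → Adj G u v × Within t u

  within? : ∀ t → Decidable (Within t)
  within? zero    v = v ≟ ρ
  within? (suc t) v = within? t v ⊎-dec Finₚ.any? (λ u → adj G u v Boolₚ.≟ true ×-dec within? t u)

  within-step : ∀ {t u v} → Adj G u v → Within t u → Within (suc t) v
  within-step u~v u-within = inj₂ (_ , u~v , u-within)

  within-walk : ∀ {t u v} (w : Reachable G u v) → Within t u → Within (t + walkLength w) v
  within-walk {t} here u-within rewrite +-identityʳ t = u-within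
  within-walk {t} (step u~v w) u-within rewrite +-suc t (walkLength w) =
    within-walk w (within-step u~v u-within)

  dist : Fin n → ℕ
  dist v = least (λ t → within? t v) (walkLength (reach v))

  dist-within : ∀ v → Within (dist v) v
  dist-within v = least-holds (λ t → within? t v) (walkLength (reach v)) (within-walk (reach v) refl)

  dist-≤ : ∀ {v s} → Within s v → dist v ≤ s
  dist-≤ {v} = least-≤ (λ t → within? t v) (walkLength (reach v))

  dist-minimal : ∀ {v s} → s < dist v → ¬ Within s v
  dist-minimal {v} = least-minimal (λ t → within? t v) (walkLength (reach v))

  dist-zero : ∀ {v} → dist v ≡ zero → v ≡ ρ
  dist-zero {v} d≡0 = subst (λ t → Within t v) d≡0 (dist-within v)

  dist-parent : ∀ {v s} → dist v ≡ suc s → ∃ λ u → Adj G u v × dist u ≡ s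
  dist-parent {v} {s} d≡1+s with subst (λ t → Within t v) d≡1+s (dist-within v)
  ... | inj₁ v-within = contradiction v-within (dist-minimal (subst (s <_) (sym d≡1+s) ≤-refl))
  ... | inj₂ (u , u~v , u-within) = u , u~v , ≤-antisym (dist-≤ u-within) (≮⇒≥ du≮s)
    where
    du≮s : ¬ dist u < s
    du≮s du<s = dist-minimal (subst (suc (dist u) <_) (sym d≡1+s) (s≤s du<s))
                             (within-step u~v (dist-within u))

  dist-rootNeighbour : ∀ {u} → Adj G ρ u → dist u ≡ 1
  dist-rootNeighbour {u} ρ~u with dist u in du | dist-≤ (within-step {zero} ρ~u refl)
  ... | suc zero    | _ = refl
  ... | suc (suc _) | s≤s ()
  ... | zero        | _ with () ← trans (sym (subst (Adj G ρ) (dist-zero du) ρ~u)) (adj-irrefl G ρ)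

  distanceParity-opposite : (∃ λ u → Adj G ρ u) → OppositeNeighbours G (parity ∘ dist)
  distanceParity-opposite ρ-neighbour v with dist v in dv
  ... | suc s with dist-parent dv
  ...   | u , u~v , du = u , u~v , trans (cong parity du) (sym (suc-homo-⁻¹ s))
  distanceParity-opposite (u , ρ~u) v | zero rewrite dist-zero dv =
    u , trans (adj-sym G u ρ) ρ~u , cong parity (dist-rootNeighbour ρ~u)

oppositeColouring : ∀ {m} (G : Graph (suc (suc m))) → Connected G → ∃ (OppositeNeighbours G)
oppositeColouring G conn =
  parity ∘ dist , distanceParity-opposite (firstNeighbour (conn Fin.zero (Fin.suc Fin.zero)) λ ())
  where open Distance G Fin.zero (conn Fin.zero)

-- A small dominating colour class

colourClass : ∀ {n} → (Fin n → Parity) → Parity → List (Fin n)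
colourClass {n} col c = filter (λ v → col v Parityₚ.≟ c) (allFin n)

≢⇒≡⁻¹ : ∀ {p q : Parity} → p ≢ q → p ≡ q ⁻¹
≢⇒≡⁻¹ {0ℙ} {0ℙ} p≢q = contradiction refl p≢q
≢⇒≡⁻¹ {0ℙ} {1ℙ} _   = refl
≢⇒≡⁻¹ {1ℙ} {0ℙ} _   = refl
≢⇒≡⁻¹ {1ℙ} {1ℙ} p≢q = contradiction refl p≢q

length-filter-⁻¹ : ∀ {a} {A : Set a} (col : A → Parity) c xs →
  length (filter (λ x → col x Parityₚ.≟ c) xs) + length (filter (λ x → col x Parityₚ.≟ c ⁻¹) xs)
    ≡ length xs
length-filter-⁻¹ col c [] = refl
length-filter-⁻¹ col c (x ∷ xs) with col x Parityₚ.≟ c | col x Parityₚ.≟ c ⁻¹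
... | yes refl | yes x≡x⁻¹ = contradiction x≡x⁻¹ (p≢p⁻¹ _)
... | yes _    | no  _     = cong suc (length-filter-⁻¹ col c xs)
... | no  _    | yes _     = trans (+-suc _ _) (cong suc (length-filter-⁻¹ col c xs))
... | no  x≢c  | no  x≢c⁻¹ = contradiction (≢⇒≡⁻¹ x≢c) x≢c⁻¹

length-colourClasses : ∀ {n} (col : Fin n → Parity) c →
  length (colourClass col c) + length (colourClass col (c ⁻¹)) ≡ n
length-colourClasses {n} col c = trans (length-filter-⁻¹ col c (allFin n)) (length-tabulate (λ v → v))

∈-colourClass : ∀ {n} {col : Fin n → Parity} {c v} → col v ≡ c → v ∈ colourClass col c
∈-colourClass {col = col} {c} {v} = ∈-filter⁺ (λ v → col v Parityₚ.≟ c) (∈-allFin v)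

colourClasses-cover : ∀ {n} (col : Fin n → Parity) c v → v ∈ colourClass col c ++ colourClass col (c ⁻¹)
colourClasses-cover col c v with col v Parityₚ.≟ c
... | yes v∈c = ∈-++⁺ˡ (∈-colourClass v∈c)
... | no  v∉c = ∈-++⁺ʳ (colourClass col c) (∈-colourClass (≢⇒≡⁻¹ v∉c))

colourClass-dominates : ∀ {n} {G : Graph n} {col} → OppositeNeighbours G col → ∀ c → Dominates G (colourClass col c)
colourClass-dominates {col = col} opposite c v with col v Parityₚ.≟ c
... | yes v∈c = v , ∈-colourClass v∈c , inj₁ refl
... | no  v∉c with opposite v
...   | u , u~v , cu = u , ∈-colourClass u∈c , inj₂ u~v
  where
  u∈c : col u ≡ c
  u∈c = trans cu (trans (cong _⁻¹ (≢⇒≡⁻¹ v∉c)) (⁻¹-involutive c))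

double≤⇒≤⌊/2⌋ : ∀ {a n} → a + a ≤ n → a ≤ ⌊ n /2⌋
double≤⇒≤⌊/2⌋ {a} 2a≤n = subst (_≤ _) (sym (n≡⌊n+n/2⌋ a)) (⌊n/2⌋-mono 2a≤n)

summand≤⌊/2⌋ : ∀ {a b n} → a + b ≡ n → a ≤ ⌊ n /2⌋ ⊎ b ≤ ⌊ n /2⌋
summand≤⌊/2⌋ {a} {b} refl with ≤-total a b
... | inj₁ a≤b = inj₁ (double≤⇒≤⌊/2⌋ (+-monoʳ-≤ a a≤b))
... | inj₂ b≤a = inj₂ (double≤⇒≤⌊/2⌋ (+-monoˡ-≤ b b≤a))

≤⌈/2⌉+⌈/2⌉ : ∀ n → n ≤ ⌈ n /2⌉ + ⌈ n /2⌉
≤⌈/2⌉+⌈/2⌉ n = subst (_≤ ⌈ n /2⌉ + ⌈ n /2⌉) (⌊n/2⌋+⌈n/2⌉≡n n) (+-monoˡ-≤ ⌈ n /2⌉ (⌊n/2⌋≤⌈n/2⌉ n))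

smallColourClass : ∀ {n} (col : Fin n → Parity) → ∃ λ c → length (colourClass col c) ≤ ⌊ n /2⌋
smallColourClass col with summand≤⌊/2⌋ (length-colourClasses col 0ℙ)
... | inj₁ small = 0ℙ , small
... | inj₂ small = 1ℙ , small

connected⇒copsWin : ∀ {n} (G : Graph n) → Connected G → CopsWin G ⌈ n /2⌉
connected⇒copsWin {zero} G _ =
  record { start = λ () ; next = λ _ () } , λ r _ → contradiction (r zero) Finₚ.¬Fin0
connected⇒copsWin {suc zero} G _ =
  dominatingList⇒copsWin G (allFin 1) [] (λ v → v , ∈-allFin v , inj₁ refl) ∈-allFin ≤-refl (s≤s z≤n)
connected⇒copsWin {suc (suc m)} G conn with oppositeColouring G conn
... | col , opposite with smallColourClass col
...   | c , |A|≤n/2 =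
  dominatingList⇒copsWin G A B (colourClass-dominates {G = G} opposite c) (colourClasses-cover col c)
    (≤-trans |A|≤n/2 (⌊n/2⌋≤⌈n/2⌉ n)) (subst (_≤ ⌈ n /2⌉ + ⌈ n /2⌉) (sym |A++B|≡n) (≤⌈/2⌉+⌈/2⌉ n))
  where
  n = suc (suc m)
  A = colourClass col c
  B = colourClass col (c ⁻¹)
  |A++B|≡n : length (A ++ B) ≡ n
  |A++B|≡n = trans (length-++ A) (length-colourClasses col c)

-- The robber's escape in complete graphs

missedVertex : ∀ {m n} → m < n → (h : Fin m → Fin n) → ∃ λ v → ∀ x → h x ≢ v
missedVertex {m} {n} m<n h with Finₚ.all? (λ v → Finₚ.any? (λ x → h x ≟ v))
... | yes onto = contradiction (Finₚ.injective⇒≤ section-injective) (<⇒≱ m<n)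
  where
  section-injective : ∀ {u v} → proj₁ (onto u) ≡ proj₁ (onto v) → u ≡ v
  section-injective {u} {v} eq = trans (sym (proj₂ (onto u))) (trans (cong h eq) (proj₂ (onto v)))
... | no ¬onto with Finₚ.¬∀⟶∃¬ n _ (λ v → Finₚ.any? (λ x → h x ≟ v)) ¬onto
...   | v , missed = v , λ x hx≡v → missed (x , hx≡v)

vertexAvoiding : ∀ {j n} → j + j < n → (c c′ : Fin j → Fin n) →
  ∃ λ v → (∀ i → c i ≢ v) × (∀ i → c′ i ≢ v)
vertexAvoiding {j} 2j<n c c′ with missedVertex 2j<n ([ c , c′ ] ∘ splitAt j)
... | v , missed =
  v , (λ i → missed (i ↑ˡ j) ∘ trans (cong [ c , c′ ] (Finₚ.splitAt-↑ˡ j i j)))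
    , (λ i → missed (j ↑ʳ i) ∘ trans (cong [ c , c′ ] (Finₚ.splitAt-↑ʳ j j i)))

K-adjacent : ∀ {n} {u v : Fin n} → u ≢ v → Adj (K n) u v
K-adjacent {n} {u} {v} u≢v with u ≟ v
... | yes u≡v = contradiction u≡v u≢v
... | no _    = refl

K-move : ∀ {n} (u v : Fin n) → Move (K n) u v
K-move u v with u ≟ v
... | yes u≡v = inj₁ u≡v
... | no  _   = inj₂ refl

K-connected : ∀ n → Connected (K n)
K-connected n u v with u ≟ v
... | yes refl = here
... | no  u≢v  = step (K-adjacent u≢v) here

module BlindCops {n j} (σ : Strategy (K n) j) where

  blindHistory : ℕ → List (Obs n)
  blindHistory zero    = nothing ∷ []
  blindHistory (suc t) = nothing ∷ nothing ∷ blindHistory t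

  blindCops : ℕ → Config n j
  blindCops zero    = start σ
  blindCops (suc t) = next σ (blindHistory t)

  module _ (2j<n : j + j < n) where

    hidingSpot : ∀ t → ∃ λ v → (∀ i → blindCops t i ≢ v) × (∀ i → blindCops (suc t) i ≢ v)
    hidingSpot t = vertexAvoiding 2j<n (blindCops t) (blindCops (suc t))

    robber : ℕ → Fin n
    robber t = proj₁ (hidingSpot t)

    unseen : ∀ (c : Config n j) v → (∀ i → c i ≢ v) → observe (K n) c v ≡ nothing
    unseen c v free = observe-nothing (K n) c v (λ i → K-adjacent (free i ∘ sym))

    open Play (K n) σ robber

    mutual
      copsAt≡blindCops : ∀ t → copsAt t ≡ blindCops t
      copsAt≡blindCops zero    = refl
      copsAt≡blindCops (suc t) = cong (next σ) (history≡blindHistory t)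

      history≡blindHistory : ∀ t → history t ≡ blindHistory t
      history≡blindHistory zero =
        cong (_∷ []) (unseen (start σ) (robber zero) (proj₁ (proj₂ (hidingSpot zero))))
      history≡blindHistory (suc t) rewrite copsAt≡blindCops (suc t) =
        cong₂ _∷_ (unseen _ (robber (suc t)) (proj₁ (proj₂ (hidingSpot (suc t)))))
          (cong₂ _∷_ (unseen _ (robber t) (proj₂ (proj₂ (hidingSpot t)))) (history≡blindHistory t))

    neverCaught : ∀ t → ¬ CaughtAt t
    neverCaught t (i , inj₁ caught) =
      proj₁ (proj₂ (hidingSpot t)) i (trans (sym (cong-app (copsAt≡blindCops t) i)) caught)
    neverCaught t (i , inj₂ caught) =
      proj₂ (proj₂ (hidingSpot t)) i (trans (sym (cong-app (copsAt≡blindCops (suc t)) i)) caught)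

K-copsLose : ∀ {n j} → j + j < n → ¬ CopsWin (K n) j
K-copsLose 2j<n (σ , winning) with winning (BlindCops.robber σ 2j<n) (λ _ → K-move _ _)
... | _ , t , caught = BlindCops.neverCaught σ 2j<n t caught

<⌈/2⌉⇒double< : ∀ {j n} → j < ⌈ n /2⌉ → j + j < n
<⌈/2⌉⇒double< {j} {n} j<⌈n/2⌉ =
  ≰⇒> λ n≤2j → <⇒≱ j<⌈n/2⌉ (subst (⌈ n /2⌉ ≤_) (sym (n≡⌈n+n/2⌉ j)) (⌈n/2⌉-mono n≤2j))

mainTheorem3 :
    ((n : ℕ) → 1 ≤ n → (G : Graph n) → Connected G →
      ∃ λ k → k ≤ ⌈ n /2⌉ × CopsWin G k)
    × ((n : ℕ) → 1 ≤ n → IsHyperopicCopNumber (K n) ⌈ n /2⌉)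
mainTheorem3 =
    (λ n _ G conn → ⌈ n /2⌉ , ≤-refl , connected⇒copsWin G conn)
  , (λ n _ → connected⇒copsWin (K n) (K-connected n) , λ j j<⌈n/2⌉ → K-copsLose (<⌈/2⌉⇒double< j<⌈n/2⌉))
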